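{- Let $R\subseteq\{0,1\}^r$ be a logical relation closed under an operation $\alpha:\{0,1\}^k\to\{0,1\}$ with $\alpha(1,\dots,1)=1$ and $\alpha(0,\dots,0)=0$. Then every connected component of $G(R)$ is closed under $\alpha$.
   Context: $G(R)$ is the subgraph of the hypercube $\{0,1\}^r$ induced by $R$ (two tuples adjacent iff they differ in exactly one coordinate). A set $T\subseteq\{0,1\}^r$ is closed under $\alpha$ if for all $\mathbf{a}^1,\dots,\mathbf{a}^k\in T$ the tuple $\alpha(\mathbf{a}^1,\dots,\mathbf{a}^k)=(\alpha(a^1_1,\dots,a^k_1),\dots,\alpha(a^1_r,\dots,a^k_r))$ is in $T$. -}

module Defs where

open import Data.Bool using (Bool; true; false)
open import Data.Nat using (ℕ; zero; suc; _+_)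
open import Data.Vec using (Vec; []; _∷_; lookup; tabulate; map; replicate)
open import Data.Fin using (Fin)
open import Relation.Binary.PropositionalEquality using (_≡_)
open import Data.Product using (_×_)

-- A logical relation of arity r: a subset of {0,1}^r (false = 0, true = 1).
Relation : ℕ → Set₁
Relation r = Vec Bool r → Set

Operation : ℕ → Set
Operation k = Vec Bool k → Bool

hamming : ∀ {r} → Vec Bool r → Vec Bool r → ℕ
hamming [] [] = 0
hamming (true ∷ xs) (true ∷ ys) = hamming xs ys
hamming (false ∷ xs) (false ∷ ys) = hamming xs ys
hamming (true ∷ xs) (false ∷ ys) = suc (hamming xs ys)
hamming (false ∷ xs) (true ∷ ys) = suc (hamming xs ys)

Adjacent : ∀ {r} → Vec Bool r → Vec Bool r → Set
Adjacent a b = hamming a b ≡ 1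

-- Walks in G(R), the subgraph of the hypercube induced by R.
-- Path R a b : a walk from a to b all of whose vertices lie in R.
data Path {r : ℕ} (R : Relation r) : Vec Bool r → Vec Bool r → Set where
  here : ∀ {a} → R a → Path R a a
  step : ∀ {a b c} → R a → Adjacent a b → Path R b c → Path R a c

Component : ∀ {r} → Relation r → Vec Bool r → Relation r
Component R x y = Path R x y

apply : ∀ {k r} → Operation k → Vec (Vec Bool r) k → Vec Bool r
apply α as = tabulate (λ i → α (map (λ a → lookup a i) as))

ClosedUnder : ∀ {k r} → Operation k → Relation r → Set
ClosedUnder {k} α T = (as : Vec (Vec Bool _) k) →
  (∀ j → T (lookup as j)) → T (apply α as)

{-# OPTIONS --safe #-}
-- Idempotence gives α(x,…,x) = x. Given walks in G(R) from x to a¹,…,aᵏ, move the arguments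
-- of α one at a time along their walks. With the other arguments fixed, α acts coordinatewise
-- on the moving one, so one step of the walk changes its image in at most one coordinate, and
-- closure of R under α keeps every image in R. Concatenating gives a walk from x to α(a¹,…,aᵏ).
module Submission where

open import Defs
open import Data.Bool using (Bool; true; false; _≟_)
open import Data.Nat using (ℕ; zero; suc; _≤_; z≤n; s≤s)
open import Data.Nat.Properties using (≤-refl; ≤-trans; ≤-reflexive; n≤1+n; n≤1⇒n≡0∨n≡1; module ≤-Reasoning)
open import Data.Vec using (Vec; replicate; []; _∷_; lookup; tabulate; map)
open import Data.Vec.Properties using (tabulate-cong; tabulate∘lookup; map-replicate; lookup-replicate)
open import Data.Fin using (Fin) renaming (zero to fzero; suc to fsuc)
open import Data.Sum as Sum using (_⊎_; inj₁; inj₂)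
open import Function using (_∘_)
open import Relation.Nullary using (yes; no; contradiction)
open import Relation.Binary.PropositionalEquality

EqualOrAdjacent : ∀ {r} → Vec Bool r → Vec Bool r → Set
EqualOrAdjacent a b = a ≡ b ⊎ Adjacent a b

hamming-∷-≡ : ∀ {r} x (xs ys : Vec Bool r) → hamming (x ∷ xs) (x ∷ ys) ≡ hamming xs ys
hamming-∷-≡ true  xs ys = refl
hamming-∷-≡ false xs ys = refl

hamming-∷-≤ : ∀ {r} x y (xs ys : Vec Bool r) → hamming (x ∷ xs) (y ∷ ys) ≤ suc (hamming xs ys)
hamming-∷-≤ true  true  xs ys = n≤1+n _
hamming-∷-≤ false false xs ys = n≤1+n _
hamming-∷-≤ true  false xs ys = ≤-refl
hamming-∷-≤ false true  xs ys = ≤-refl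

hamming-∷-≢ : ∀ {r} {x y} → x ≢ y → (xs ys : Vec Bool r) → hamming (x ∷ xs) (y ∷ ys) ≡ suc (hamming xs ys)
hamming-∷-≢ {x = true}  {true}  x≢y xs ys = contradiction refl x≢y
hamming-∷-≢ {x = false} {false} x≢y xs ys = contradiction refl x≢y
hamming-∷-≢ {x = true}  {false} x≢y xs ys = refl
hamming-∷-≢ {x = false} {true}  x≢y xs ys = refl

hamming≡0⇒≡ : ∀ {r} (a b : Vec Bool r) → hamming a b ≡ 0 → a ≡ b
hamming≡0⇒≡ []           []           _  = refl
hamming≡0⇒≡ (true ∷ a)   (true ∷ b)   eq = cong (true ∷_) (hamming≡0⇒≡ a b eq)
hamming≡0⇒≡ (false ∷ a)  (false ∷ b)  eq = cong (false ∷_) (hamming≡0⇒≡ a b eq)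
hamming≡0⇒≡ (true ∷ a)   (false ∷ b)  ()
hamming≡0⇒≡ (false ∷ a)  (true ∷ b)   ()

hamming≤1⇒equalOrAdjacent : ∀ {r} (a b : Vec Bool r) → hamming a b ≤ 1 → EqualOrAdjacent a b
hamming≤1⇒equalOrAdjacent a b h≤1 = Sum.map₁ (hamming≡0⇒≡ a b) (n≤1⇒n≡0∨n≡1 h≤1)

coordinatewise : ∀ {r} → (Fin r → Bool → Bool) → Vec Bool r → Vec Bool r
coordinatewise g a = tabulate (λ i → g i (lookup a i))

hamming-coordinatewise-≤ : ∀ {r} (g : Fin r → Bool → Bool) (a b : Vec Bool r) →
  hamming (coordinatewise g a) (coordinatewise g b) ≤ hamming a b
hamming-coordinatewise-≤ g []      []      = z≤n
hamming-coordinatewise-≤ {suc r} g (x ∷ a) (y ∷ b) with x ≟ y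
... | yes refl = begin
  hamming (g fzero x ∷ ga) (g fzero x ∷ gb) ≡⟨ hamming-∷-≡ (g fzero x) ga gb ⟩
  hamming ga gb                             ≤⟨ hamming-coordinatewise-≤ (g ∘ fsuc) a b ⟩
  hamming a b                               ≡⟨ hamming-∷-≡ x a b ⟨
  hamming (x ∷ a) (x ∷ b)                   ∎
  where
  open ≤-Reasoning
  ga gb : Vec Bool r
  ga = coordinatewise (g ∘ fsuc) a
  gb = coordinatewise (g ∘ fsuc) b
... | no x≢y = begin
  hamming (g fzero x ∷ ga) (g fzero y ∷ gb) ≤⟨ hamming-∷-≤ (g fzero x) (g fzero y) ga gb ⟩
  suc (hamming ga gb)                       ≤⟨ s≤s (hamming-coordinatewise-≤ (g ∘ fsuc) a b) ⟩
  suc (hamming a b)                         ≡⟨ hamming-∷-≢ x≢y a b ⟨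
  hamming (x ∷ a) (y ∷ b)                   ∎
  where
  open ≤-Reasoning
  ga gb : Vec Bool r
  ga = coordinatewise (g ∘ fsuc) a
  gb = coordinatewise (g ∘ fsuc) b

coordinatewise-adjacent : ∀ {r} (g : Fin r → Bool → Bool) (a b : Vec Bool r) →
  Adjacent a b → EqualOrAdjacent (coordinatewise g a) (coordinatewise g b)
coordinatewise-adjacent g a b a~b =
  hamming≤1⇒equalOrAdjacent _ _ (≤-trans (hamming-coordinatewise-≤ g a b) (≤-reflexive a~b))

module _ {r : ℕ} {R : Relation r} where

  Path-source : ∀ {a b} → Path R a b → R a
  Path-source (here ra)     = ra
  Path-source (step ra _ _) = ra

  Path-target : ∀ {a b} → Path R a b → R b
  Path-target (here rb)    = rb
  Path-target (step _ _ p) = Path-target p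

  Path-++ : ∀ {a b c} → Path R a b → Path R b c → Path R a c
  Path-++ (here _)        q = q
  Path-++ (step ra a~b p) q = step ra a~b (Path-++ p q)

Path-map : ∀ {r s} {R : Relation r} {S : Relation s} (f : Vec Bool r → Vec Bool s) →
  (∀ {a} → R a → S (f a)) →
  (∀ a b → Adjacent a b → EqualOrAdjacent (f a) (f b)) →
  ∀ {u v} → Path R u v → Path S (f u) (f v)
Path-map f preserves _ (here ru) = here (preserves ru)
Path-map {S = S} f preserves adjacent {v = v} (step ra a~b p) with adjacent _ _ a~b
... | inj₁ fa≡fb = subst (λ z → Path S z (f v)) (sym fa≡fb) (Path-map f preserves adjacent p)
... | inj₂ fa~fb = step (preserves ra) fa~fb (Path-map f preserves adjacent p)

-- Fixing the first argument of α at a tuple v leaves an operation that depends on the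
-- coordinate i through vᵢ, so the induction on the arity runs over coordinate-indexed families.
applyFamily : ∀ {k r} → (Fin r → Operation k) → Vec (Vec Bool r) k → Vec Bool r
applyFamily αs as = tabulate (λ i → αs i (map (λ a → lookup a i) as))

ClosedUnderFamily : ∀ {k r} → (Fin r → Operation k) → Relation r → Set
ClosedUnderFamily {k} αs T = (as : Vec (Vec Bool _) k) →
  (∀ j → T (lookup as j)) → T (applyFamily αs as)

Path-applyFamily : ∀ {r} {R : Relation r} k (αs : Fin r → Operation k) → ClosedUnderFamily αs R →
  (us vs : Vec (Vec Bool r) k) → (∀ j → Path R (lookup us j) (lookup vs j)) →
  Path R (applyFamily αs us) (applyFamily αs vs)
Path-applyFamily zero    αs closed []       []       paths = here (closed [] λ ())
Path-applyFamily {R = R} (suc k) αs closed (u ∷ us) (v ∷ vs) paths =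
  Path-++ (Path-map varyFirst varyFirst-preserves (coordinatewise-adjacent withFirst) (paths fzero))
          (Path-applyFamily k fixFirst fixFirst-closed us vs (paths ∘ fsuc))
  where
  withFirst : Fin _ → Bool → Bool
  withFirst i c = αs i (c ∷ map (λ a → lookup a i) us)

  varyFirst : Vec Bool _ → Vec Bool _
  varyFirst = coordinatewise withFirst

  varyFirst-preserves : ∀ {a} → R a → R (varyFirst a)
  varyFirst-preserves ra = closed (_ ∷ us) λ where
    fzero    → ra
    (fsuc j) → Path-source (paths (fsuc j))

  fixFirst : Fin _ → Operation k
  fixFirst i w = αs i (lookup v i ∷ w)

  fixFirst-closed : ClosedUnderFamily fixFirst R
  fixFirst-closed ws rws = closed (v ∷ ws) λ where
    fzero    → Path-target (paths fzero)
    (fsuc j) → rws j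

apply-replicate : ∀ {k r} (α : Operation k) → (∀ b → α (replicate k b) ≡ b) →
  (x : Vec Bool r) → apply α (replicate k x) ≡ x
apply-replicate {k} α idempotent x = begin
  tabulate (λ i → α (map (λ a → lookup a i) (replicate k x))) ≡⟨ tabulate-cong (λ i → cong α (map-replicate _ x k)) ⟩
  tabulate (λ i → α (replicate k (lookup x i)))               ≡⟨ tabulate-cong (idempotent ∘ lookup x) ⟩
  tabulate (lookup x)                                         ≡⟨ tabulate∘lookup x ⟩
  x                                                           ∎
  where open ≡-Reasoning

lemma4p1 : (r k : ℕ) (R : Relation r) (α : Operation k) →
    ClosedUnder α R →
    α (replicate k true) ≡ true →
    α (replicate k false) ≡ false →
    (x : Vec Bool r) → R x → ClosedUnder α (Component R x)
lemma4p1 r k R α closed α-true α-false x _ as paths =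
  subst (λ z → Path R z (apply α as)) (apply-replicate α idempotent x)
    (Path-applyFamily k (λ _ → α) closed (replicate k x) as fromX)
  where
  idempotent : ∀ b → α (replicate k b) ≡ b
  idempotent true  = α-true
  idempotent false = α-false

  fromX : ∀ j → Path R (lookup (replicate k x) j) (lookup as j)
  fromX j = subst (λ z → Path R z (lookup as j)) (sym (lookup-replicate j x)) (paths j)
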